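{- Let $m\ge1$ and $0\le s\le k$ be integers with $k\ge1$. Then \[\operatorname{forb}(m,3,2\cdot K_k^s)=\sum_{i=0}^{k-1}\binom{m}{i}2^{m-i}+\binom{m}{k}.\]
   Context: A $3$-matrix is a matrix with entries in $\{0,1,2\}$. A matrix is simple if it has no repeated columns. For matrices $F$ and $A$, $A$ avoids $F$ if no submatrix of $A$ is a row and column permutation of $F$. $\operatorname{forb}(m,3,F)$ is the maximum number of columns of a simple $m$-rowed $3$-matrix that avoids $F$. $K_k^s$ is the $k\times\binom ks$ matrix of all $(0,1)$-columns of length $k$ with exactly $s$ ones; $2\cdot K_k^s$ is two copies of it side by side. -}

module Defs where

open import Data.Nat using (ℕ; zero; suc; _+_; _*_; _∸_; _^_; _≤_)
open import Data.Nat.Combinatorics using (_C_)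
open import Data.Fin using (Fin; zero; suc)
open import Data.Vec using (Vec; []; _∷_; lookup)
open import Data.List using (List; []; _∷_; _++_; map; length; upTo)
open import Data.Nat.ListAction using (sum)
import Data.List as L
open import Data.List.Relation.Unary.Unique.Propositional using (Unique)
open import Data.Product using (Σ; _×_; ∃-syntax)
open import Relation.Binary.PropositionalEquality using (_≡_)
open import Relation.Nullary using (¬_)
open import Function.Definitions using (Injective)

-- A 3-matrix with r rows is represented by the list of its columns;
-- each column is a vector of length r with entries in {0,1,2} = Fin 3.
Matrix : ℕ → Set
Matrix r = List (Vec (Fin 3) r)

ncols : ∀ {r} → Matrix r → ℕ
ncols = length

entry : ∀ {r} (A : Matrix r) → Fin r → Fin (ncols A) → Fin 3
entry A i j = lookup (L.lookup A j) i

Simple : ∀ {r} → Matrix r → Set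
Simple A = Unique A

-- A contains F as a configuration: some submatrix of A is a row and column
-- permutation of F, i.e. there are injective row/column selections ρ, σ with
-- A[ρ i, σ j] = F[i, j].
Contains : ∀ {m k} → Matrix m → Matrix k → Set
Contains {m} {k} A F =
  Σ (Fin k → Fin m) λ ρ → Injective _≡_ _≡_ ρ ×
  Σ (Fin (ncols F) → Fin (ncols A)) λ σ → Injective _≡_ _≡_ σ ×
  (∀ i j → entry A (ρ i) (σ j) ≡ entry F i j)

Avoids : ∀ {m k} → Matrix m → Matrix k → Set
Avoids A F = ¬ Contains A F

IsForb : (m : ℕ) → ∀ {k} → Matrix k → ℕ → Set
IsForb m F n =
  (Σ (Matrix m) λ A → Simple A × Avoids A F × ncols A ≡ n) ×
  (∀ (A : Matrix m) → Simple A → Avoids A F → ncols A ≤ n)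

-- K_k^s : all (0,1)-columns of length k with exactly s ones (column order is
-- irrelevant since containment allows column permutations).
K : (k s : ℕ) → Matrix k
K zero zero = [] ∷ []
K zero (suc s) = []
K (suc k) zero = map (zero ∷_) (K k zero)
K (suc k) (suc s) = map (zero ∷_) (K k (suc s)) ++ map (suc zero ∷_) (K k s)

twoK : (k s : ℕ) → Matrix k
twoK k s = K k s ++ K k s

bound : (m k : ℕ) → ℕ
bound m k = sum (map (λ i → (m C i) * 2 ^ (m ∸ i)) (upTo k)) + (m C k)

module Submission where

-- Write S m k = Σ_{i<k} C(m,i)·2^(m-i).  A column c "reads" a 0/1-word y on a set R
-- of rows if the restriction of c to R is y.
--
-- The key inequality (weight-bound): for every 0/1 weight a on the 3^m
-- columns and every choice of a 0/1-word σ R on each row set R,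
--     Σ_c a(c) ≤ S m k + Σ_{|R|=k} Σ_{c reads σ R on R} a(c).
-- It is proved by induction on m: split the columns by their first entry and replace
-- the slices 0 and 1 by their pointwise max and min.  If A is simple and avoids
-- 2·K_k^s, then on every k-set R some column of K_k^s is read by at most one column
-- of A (doubled-contains), so A has at most S m k + C(m,k) columns.
--
-- With t = k - s, the matrix Opt m s t consists of the S m k columns
-- avoiding the word 1^s 0^t as a subsequence and the C(m,k) columns whose non-2
-- entries spell exactly 1^s 0^t.  On every k-set R at most one of its columns reads
-- 1^s 0^t (Opt-read-once), so no copy of 2·K_k^s fits (Opt-avoids).

open import Defs
open import Data.Bool using (Bool; true; false; if_then_else_; _∧_; _∨_; T)
open import Data.Empty using (⊥-elim)
open import Data.Fin using (Fin; zero; suc; _≟_)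
open import Data.Fin.Properties using () renaming (suc-injective to fin-suc-injective; 0≢1+n to fin-0≢1+n)
open import Data.List using (List; []; _∷_; _++_; [_]; map; upTo; _∷ʳ_; length)
import Data.List as L
open import Data.List.Membership.Propositional using (_∈_)
open import Data.List.Membership.Propositional.Properties
  using (∈-lookup; ∈-map⁻; ∈-map⁺; ∈-++⁻; ∈-++⁺ˡ; ∈-++⁺ʳ)
open import Data.List.Properties using (upTo-∷ʳ; map-++; map-∘; length-++; length-map)
open import Data.List.Relation.Binary.Disjoint.Propositional using (Disjoint)
open import Data.List.Relation.Unary.All using (All; []; _∷_) renaming (lookup to all-lookup)
import Data.List.Relation.Unary.All.Properties as All
open import Data.List.Relation.Unary.AllPairs using ([]; _∷_)
open import Data.List.Relation.Unary.Any using (here; index)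
open import Data.List.Relation.Unary.Any.Properties using (lookup-index)
open import Data.List.Relation.Unary.Unique.Propositional using (Unique)
import Data.List.Relation.Unary.Unique.Propositional.Properties as Unique
open import Data.Nat using (ℕ; zero; suc; _+_; _*_; _∸_; _^_; _≤_; _<_; _<?_; _≤ᵇ_; s<s⁻¹; z≤n; s≤s; _⊔_; _⊓_)
open import Data.Nat.Combinatorics using (_C_; nCk+nC[k+1]≡[n+1]C[k+1]; k>n⇒nCk≡0)
open import Data.Nat.ListAction using (sum)
open import Data.Nat.ListAction.Properties using (sum-++)
open import Data.Nat.Properties hiding (_≟_)
open import Algebra.Properties.CommutativeMonoid.Sum +-0-commutativeMonoid
  using (sum-cong-≗; ∑-distrib-+; sum-replicate-zero) renaming (sum to ∑)
open import Data.Nat.Solver using (module +-*-Solver)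
open import Data.Product using (Σ; _×_; _,_; proj₁; proj₂)
import Data.Product as Product
open import Data.Sum using (_⊎_; inj₁; inj₂; [_,_]′)
import Data.Sum as Sum
open import Data.Unit using (tt)
open import Data.Vec using (Vec; []; _∷_; lookup)
import Data.Vec as V
open import Data.Vec.Properties
  using (≡-dec; ∷-injectiveʳ; lookup∘tabulate; lookup-map; tabulate∘lookup; tabulate-cong)
open import Function using (_∘_; _∘′_; id)
open import Function.Definitions using (Injective)
open import Relation.Binary.PropositionalEquality
  using (_≡_; _≢_; refl; sym; trans; cong; cong₂; subst; subst₂; module ≡-Reasoning)
open import Relation.Nullary using (yes; no; does)
open +-*-Solver using (solve; _:=_; _:+_; _:*_; con)

-- S m k = Σ_{i<k} C(m,i)·2^(m-i), so that  bound m k = S m k + C(m,k)  definitionally.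
-- S m k counts the {0,1,2}-columns of length m that do not contain a fixed word
-- of length k over {0,1} as a subsequence; this is reflected by S-pascal below.
S : ℕ → ℕ → ℕ
S m k = sum (map (λ i → (m C i) * 2 ^ (m ∸ i)) (upTo k))

S-suc : ∀ m k → S m (suc k) ≡ S m k + (m C k) * 2 ^ (m ∸ k)
S-suc m k = begin
  sum (map term (upTo (suc k)))          ≡⟨ cong (sum ∘′ map term) (sym (upTo-∷ʳ k)) ⟩
  sum (map term (upTo k ∷ʳ k))           ≡⟨ cong sum (map-++ term (upTo k) [ k ]) ⟩
  sum (map term (upTo k) ++ [ term k ])  ≡⟨ sum-++ (map term (upTo k)) [ term k ] ⟩
  S m k + (term k + 0)                   ≡⟨ cong (S m k +_) (+-identityʳ (term k)) ⟩
  S m k + term k                         ∎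
  where
  open ≡-Reasoning
  term : ℕ → ℕ
  term i = (m C i) * 2 ^ (m ∸ i)

-- With no rows, only the empty column exists and it avoids every nonempty word.
S-no-rows : ∀ k → S 0 (suc k) ≡ 1
S-no-rows zero    = refl
S-no-rows (suc k) = trans (S-suc 0 (suc k)) (trans (+-identityʳ _) (S-no-rows k))

-- C(m,k+1)·2^(m-k) = 2·C(m,k+1)·2^(m-k-1): if k < m the power halves, otherwise
-- the binomial coefficient vanishes.
halve-term : ∀ m k → (m C suc k) * 2 ^ (m ∸ k) ≡ 2 * ((m C suc k) * 2 ^ (m ∸ suc k))
halve-term m k with k <? m
... | yes k<m = begin
  (m C suc k) * 2 ^ (m ∸ k)            ≡⟨ cong (λ e → (m C suc k) * 2 ^ e) (+-∸-assoc 1 k<m) ⟩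
  (m C suc k) * (2 * 2 ^ (m ∸ suc k))  ≡⟨ solve 2 (λ x y → x :* (con 2 :* y) := con 2 :* (x :* y))
                                                   refl (m C suc k) (2 ^ (m ∸ suc k)) ⟩
  2 * ((m C suc k) * 2 ^ (m ∸ suc k))  ∎
  where open ≡-Reasoning
... | no k≮m rewrite k>n⇒nCk≡0 {m} {suc k} (s≤s (≮⇒≥ k≮m)) = refl

-- The Pascal-type recurrence: a column of length m+1 avoids the word x·w iff its
-- first entry is one of the two symbols ≠ x and its tail avoids x·w, or its first
-- entry is x and its tail avoids w.
S-pascal : ∀ m k → S (suc m) (suc k) ≡ S m (suc k) + S m k + S m (suc k)
S-pascal m zero = solve 1 (λ x → con 1 :* (con 2 :* x) :+ con 0
                              := (con 1 :* x :+ con 0) :+ con 0 :+ (con 1 :* x :+ con 0)) refl (2 ^ m)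
S-pascal m (suc k) = begin
  S (suc m) (suc (suc k))
    ≡⟨ S-suc (suc m) (suc k) ⟩
  S (suc m) (suc k) + (suc m C suc k) * P
    ≡⟨ cong₂ _+_ (S-pascal m k) (cong (_* P) (sym (nCk+nC[k+1]≡[n+1]C[k+1] m k))) ⟩
  (a + b + a) + ((m C k) + (m C suc k)) * P
    ≡⟨ cong ((a + b + a) +_) (*-distribʳ-+ P (m C k) (m C suc k)) ⟩
  (a + b + a) + (c + (m C suc k) * P)
    ≡⟨ cong (λ z → (a + b + a) + (c + z)) (halve-term m k) ⟩
  (a + b + a) + (c + 2 * x)
    ≡⟨ solve 4 (λ a b c x → (a :+ b :+ a) :+ (c :+ con 2 :* x) := (a :+ x) :+ (b :+ c) :+ (a :+ x))
             refl a b c x ⟩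
  (a + x) + (b + c) + (a + x)
    ≡⟨ sym (cong₂ _+_ (cong₂ _+_ (S-suc m (suc k)) (S-suc m k)) (S-suc m (suc k))) ⟩
  S m (suc (suc k)) + S m (suc k) + S m (suc (suc k)) ∎
  where
  open ≡-Reasoning
  a b P c x : ℕ
  a = S m (suc k)
  b = S m k
  P = 2 ^ (m ∸ k)
  c = (m C k) * P
  x = (m C suc k) * 2 ^ (m ∸ suc k)

pattern f0 = zero
pattern f1 = suc zero
pattern f2 = suc (suc zero)

Col : ℕ → Set
Col m = Vec (Fin 3) m

sumCols : (m : ℕ) → (Col m → ℕ) → ℕ
sumCols zero    f = f []
sumCols (suc m) f = sumCols m (f ∘ (f0 ∷_)) + sumCols m (f ∘ (f1 ∷_)) + sumCols m (f ∘ (f2 ∷_))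

sumCols-mono : ∀ m {f g : Col m → ℕ} → (∀ c → f c ≤ g c) → sumCols m f ≤ sumCols m g
sumCols-mono zero    f≤g = f≤g []
sumCols-mono (suc m) f≤g = +-mono-≤ (+-mono-≤ (sumCols-mono m (f≤g ∘ (f0 ∷_)))
                                              (sumCols-mono m (f≤g ∘ (f1 ∷_))))
                                    (sumCols-mono m (f≤g ∘ (f2 ∷_)))

sumCols-cong : ∀ m {f g : Col m → ℕ} → (∀ c → f c ≡ g c) → sumCols m f ≡ sumCols m g
sumCols-cong m f≡g = ≤-antisym (sumCols-mono m (≤-reflexive ∘ f≡g))
                               (sumCols-mono m (≤-reflexive ∘ sym ∘ f≡g))

sumCols-+ : ∀ m (f g : Col m → ℕ) → sumCols m (λ c → f c + g c) ≡ sumCols m f + sumCols m g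
sumCols-+ zero    f g = refl
sumCols-+ (suc m) f g =
  trans (cong₂ _+_ (cong₂ _+_ (sumCols-+ m (f ∘ (f0 ∷_)) (g ∘ (f0 ∷_)))
                              (sumCols-+ m (f ∘ (f1 ∷_)) (g ∘ (f1 ∷_))))
                   (sumCols-+ m (f ∘ (f2 ∷_)) (g ∘ (f2 ∷_))))
        (interchange (sumCols m (f ∘ (f0 ∷_))) (sumCols m (f ∘ (f1 ∷_))) (sumCols m (f ∘ (f2 ∷_)))
                     (sumCols m (g ∘ (f0 ∷_))) (sumCols m (g ∘ (f1 ∷_))) (sumCols m (g ∘ (f2 ∷_))))
  where
  interchange : ∀ a b c d e h → (a + d) + (b + e) + (c + h) ≡ (a + b + c) + (d + e + h)
  interchange = solve 6 (λ a b c d e h → (a :+ d) :+ (b :+ e) :+ (c :+ h)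
                                       := (a :+ b :+ c) :+ (d :+ e :+ h)) refl

sumCols-zero : ∀ m (f : Col m → ℕ) → (∀ c → f c ≡ 0) → sumCols m f ≡ 0
sumCols-zero zero    f f≡0 = f≡0 []
sumCols-zero (suc m) f f≡0
  rewrite sumCols-zero m _ (f≡0 ∘ (f0 ∷_)) | sumCols-zero m _ (f≡0 ∘ (f1 ∷_))
        | sumCols-zero m _ (f≡0 ∘ (f2 ∷_)) = refl

RowSet : ℕ → Set
RowSet m = Vec Bool m

size : ∀ {m} → RowSet m → ℕ
size []          = 0
size (true ∷ R)  = suc (size R)
size (false ∷ R) = size R

rowOf : ∀ {m} (R : RowSet m) → Fin (size R) → Fin m
rowOf (false ∷ R) i       = suc (rowOf R i)
rowOf (true ∷ R)  zero    = zero
rowOf (true ∷ R)  (suc i) = suc (rowOf R i)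

rowOf-injective : ∀ {m} (R : RowSet m) → Injective _≡_ _≡_ (rowOf R)
rowOf-injective (false ∷ R) e = rowOf-injective R (fin-suc-injective e)
rowOf-injective (true ∷ R) {zero}  {zero}  e = refl
rowOf-injective (true ∷ R) {suc i} {suc j} e = cong suc (rowOf-injective R (fin-suc-injective e))

sumSubsets : (m k : ℕ) → (RowSet m → ℕ) → ℕ
sumSubsets zero    zero    F = F []
sumSubsets zero    (suc k) F = 0
sumSubsets (suc m) zero    F = sumSubsets m zero (F ∘ (false ∷_))
sumSubsets (suc m) (suc k) F = sumSubsets m (suc k) (F ∘ (false ∷_)) + sumSubsets m k (F ∘ (true ∷_))

sumSubsets-mono : ∀ m k {F G : RowSet m → ℕ} → (∀ R → size R ≡ k → F R ≤ G R) →
                  sumSubsets m k F ≤ sumSubsets m k G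
sumSubsets-mono zero    zero    F≤G = F≤G [] refl
sumSubsets-mono zero    (suc k) F≤G = z≤n
sumSubsets-mono (suc m) zero    F≤G = sumSubsets-mono m zero (λ R → F≤G (false ∷ R))
sumSubsets-mono (suc m) (suc k) F≤G =
  +-mono-≤ (sumSubsets-mono m (suc k) (λ R → F≤G (false ∷ R)))
           (sumSubsets-mono m k (λ R e → F≤G (true ∷ R) (cong suc e)))

sumSubsets-+ : ∀ m k (F G : RowSet m → ℕ) →
               sumSubsets m k (λ R → F R + G R) ≡ sumSubsets m k F + sumSubsets m k G
sumSubsets-+ zero    zero    F G = refl
sumSubsets-+ zero    (suc k) F G = refl
sumSubsets-+ (suc m) zero    F G = sumSubsets-+ m zero (F ∘ (false ∷_)) (G ∘ (false ∷_))
sumSubsets-+ (suc m) (suc k) F G =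
  trans (cong₂ _+_ (sumSubsets-+ m (suc k) (F ∘ (false ∷_)) (G ∘ (false ∷_)))
                   (sumSubsets-+ m k (F ∘ (true ∷_)) (G ∘ (true ∷_))))
        (solve 4 (λ a b c d → (a :+ b) :+ (c :+ d) := (a :+ c) :+ (b :+ d)) refl
               (sumSubsets m (suc k) (F ∘ (false ∷_))) (sumSubsets m (suc k) (G ∘ (false ∷_)))
               (sumSubsets m k (F ∘ (true ∷_))) (sumSubsets m k (G ∘ (true ∷_))))

sumSubsets-count : ∀ m k → sumSubsets m k (λ _ → 1) ≡ m C k
sumSubsets-count zero    zero    = refl
sumSubsets-count zero    (suc k) = refl
sumSubsets-count (suc m) zero    = sumSubsets-count m zero
sumSubsets-count (suc m) (suc k) =
  trans (cong₂ _+_ (sumSubsets-count m (suc k)) (sumSubsets-count m k))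
        (trans (+-comm (m C suc k) (m C k)) (nCk+nC[k+1]≡[n+1]C[k+1] m k))

bit : Bool → Fin 3
bit false = f0
bit true  = f1

embed : ∀ {n} → Vec Bool n → Col n
embed = V.map bit

matches : ∀ {m} (R : RowSet m) → Col (size R) → Col m → Bool
matches []          _       []      = true
matches (false ∷ R) y       (v ∷ c) = matches R y c
matches (true ∷ R)  (x ∷ y) (v ∷ c) = does (v ≟ x) ∧ matches R y c

matches-sound : ∀ {m} (R : RowSet m) y (c : Col m) → matches R y c ≡ true →
                ∀ i → lookup c (rowOf R i) ≡ lookup y i
matches-sound (false ∷ R) y       (v ∷ c) eq i = matches-sound R y c eq i
matches-sound (true ∷ R)  (x ∷ y) (v ∷ c) eq i with v ≟ x
matches-sound (true ∷ R)  (x ∷ y) (v ∷ c) eq zero    | yes v≡x = v≡x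
matches-sound (true ∷ R)  (x ∷ y) (v ∷ c) eq (suc i) | yes _   = matches-sound R y c eq i

matchWeight : ∀ m → (Col m → ℕ) → (R : RowSet m) → Col (size R) → ℕ
matchWeight m a R y = sumCols m (λ c → if matches R y c then a c else 0)

if-mono : ∀ (b : Bool) {x y} → x ≤ y → (if b then x else 0) ≤ (if b then y else 0)
if-mono true  x≤y = x≤y
if-mono false x≤y = z≤n

if-⊔ : ∀ (b : Bool) x y → (if b then x ⊔ y else 0) ≤ (if b then x else 0) + (if b then y else 0)
if-⊔ true  x y = m⊔n≤m+n x y
if-⊔ false x y = z≤n

⊔+⊓ : ∀ x y → x ⊔ y + x ⊓ y ≡ x + y
⊔+⊓ x y with ≤-total x y
... | inj₁ x≤y rewrite m≤n⇒m⊔n≡n x≤y | m≤n⇒m⊓n≡m x≤y = +-comm y x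
... | inj₂ y≤x rewrite m≥n⇒m⊔n≡m y≤x | m≥n⇒m⊓n≡n y≤x = refl

-- For k = 0 the only row set is ∅, which every column matches.
weight-bound-empty : ∀ m (a : Col m → ℕ) (y : (R : RowSet m) → Col (size R)) →
                     sumCols m a ≤ sumSubsets m 0 (λ R → matchWeight m a R (y R))
weight-bound-empty zero    a y = ≤-refl
weight-bound-empty (suc m) a y = begin
  sumCols m (slice f0) + sumCols m (slice f1) + sumCols m (slice f2)
    ≤⟨ +-mono-≤ (+-mono-≤ (IH f0) (IH f1)) (IH f2) ⟩
  Z f0 + Z f1 + Z f2
    ≡⟨ sym (trans (sumSubsets-+ m 0 (λ R → W f0 R + W f1 R) (W f2))
                  (cong (_+ Z f2) (sumSubsets-+ m 0 (W f0) (W f1)))) ⟩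
  sumSubsets m 0 (λ R → W f0 R + W f1 R + W f2 R) ∎
  where
  open ≤-Reasoning
  slice : Fin 3 → Col m → ℕ
  slice v c = a (v ∷ c)
  W : Fin 3 → RowSet m → ℕ
  W v R = matchWeight m (slice v) R (y (false ∷ R))
  Z : Fin 3 → ℕ
  Z v = sumSubsets m 0 (W v)
  IH : ∀ v → sumCols m (slice v) ≤ Z v
  IH v = weight-bound-empty m (slice v) (y ∘ (false ∷_))

-- The inductive step splits a weight on columns of length m+1 into its slices by the
-- first entry, and replaces slices 0 and 1 by their pointwise max and min.
module Shift {m} (a : Col (suc m) → ℕ) where

  slice : Fin 3 → Col m → ℕ
  slice v c = a (v ∷ c)

  hi lo : Col m → ℕ
  hi c = slice f0 c ⊔ slice f1 c
  lo c = slice f0 c ⊓ slice f1 c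

  total-split : sumCols (suc m) a ≡ sumCols m hi + sumCols m lo + sumCols m (slice f2)
  total-split = cong (_+ sumCols m (slice f2)) (begin
    sumCols m (slice f0) + sumCols m (slice f1)   ≡⟨ sumCols-+ m (slice f0) (slice f1) ⟨
    sumCols m (λ c → slice f0 c + slice f1 c)     ≡⟨ sumCols-cong m (λ c → ⊔+⊓ (slice f0 c) (slice f1 c)) ⟨
    sumCols m (λ c → hi c + lo c)                 ≡⟨ sumCols-+ m hi lo ⟩
    sumCols m hi + sumCols m lo                   ∎)
    where open ≡-Reasoning

  -- If row 1 ∉ R, all three slices contribute; merging slices 0 and 1 by max loses weight.
  free-row : ∀ R y → matchWeight m hi R y + matchWeight m (slice f2) R y
                     ≤ matchWeight (suc m) a (false ∷ R) y
  free-row R y = +-monoˡ-≤ (matchWeight m (slice f2) R y)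
    (≤-trans (sumCols-mono m (λ c → if-⊔ (matches R y c) (slice f0 c) (slice f1 c)))
             (≤-reflexive (sumCols-+ m (λ c → if matches R y c then slice f0 c else 0)
                                       (λ c → if matches R y c then slice f1 c else 0))))

  -- If row 1 ∈ R and the word starts with the bit b, only slice b contributes,
  -- and it dominates the pointwise min.
  fixed-row : ∀ R (p : Vec Bool (suc (size R))) →
              matchWeight m lo R (embed (V.tail p)) ≤ matchWeight (suc m) a (true ∷ R) (embed p)
  fixed-row R (false ∷ q) =
    ≤-trans (sumCols-mono m (λ c → if-mono (matches R (embed q) c) (m⊓n≤m (slice f0 c) (slice f1 c))))
            (≤-trans (m≤m+n _ _) (m≤m+n _ _))
  fixed-row R (true ∷ q) =
    ≤-trans (sumCols-mono m (λ c → if-mono (matches R (embed q) c) (m⊓n≤n (slice f0 c) (slice f1 c))))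
            (≤-trans (m≤n+m _ (sumCols m (λ _ → 0))) (m≤m+n _ _))

weight-bound : ∀ m k (a : Col m → ℕ) → (∀ c → a c ≤ 1) → (σ : (R : RowSet m) → Vec Bool (size R)) →
               sumCols m a ≤ S m k + sumSubsets m k (λ R → matchWeight m a R (embed (σ R)))
weight-bound m       zero    a _   σ = weight-bound-empty m a (embed ∘ σ)
weight-bound zero    (suc k) a a≤1 σ = subst (λ z → a [] ≤ z + 0) (sym (S-no-rows k)) (a≤1 [])
weight-bound (suc m) (suc k) a a≤1 σ = begin
  sumCols (suc m) a
    ≡⟨ total-split ⟩
  sumCols m hi + sumCols m lo + sumCols m (slice f2)
    ≤⟨ +-mono-≤ (+-mono-≤ IH-hi IH-lo) IH-2 ⟩
  (S₁ + Y-hi) + (S₀ + Y-lo) + (S₁ + Y-2)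
    ≡⟨ solve 5 (λ s₁ s₀ y₁ y₂ y₃ → (s₁ :+ y₁) :+ (s₀ :+ y₂) :+ (s₁ :+ y₃)
                                 := (s₁ :+ s₀ :+ s₁) :+ ((y₁ :+ y₃) :+ y₂)) refl S₁ S₀ Y-hi Y-lo Y-2 ⟩
  (S₁ + S₀ + S₁) + ((Y-hi + Y-2) + Y-lo)
    ≤⟨ +-mono-≤ (≤-reflexive (sym (S-pascal m k))) (+-mono-≤ free fixed) ⟩
  S (suc m) (suc k) + sumSubsets (suc m) (suc k) (λ R → matchWeight (suc m) a R (embed (σ R))) ∎
  where
  open ≤-Reasoning
  open Shift a
  σ-out : (R : RowSet m) → Vec Bool (size R)
  σ-out R = σ (false ∷ R)
  σ-in : (R : RowSet m) → Vec Bool (size R)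
  σ-in R = V.tail (σ (true ∷ R))
  S₁ S₀ Y-hi Y-lo Y-2 : ℕ
  S₁ = S m (suc k)
  S₀ = S m k
  Y-hi = sumSubsets m (suc k) (λ R → matchWeight m hi R (embed (σ-out R)))
  Y-lo = sumSubsets m k (λ R → matchWeight m lo R (embed (σ-in R)))
  Y-2  = sumSubsets m (suc k) (λ R → matchWeight m (slice f2) R (embed (σ-out R)))
  IH-hi : sumCols m hi ≤ S₁ + Y-hi
  IH-hi = weight-bound m (suc k) hi (λ c → ⊔-lub (a≤1 (f0 ∷ c)) (a≤1 (f1 ∷ c))) σ-out
  IH-lo : sumCols m lo ≤ S₀ + Y-lo
  IH-lo = weight-bound m k lo (λ c → ≤-trans (m⊓n≤m _ _) (a≤1 (f0 ∷ c))) σ-in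
  IH-2 : sumCols m (slice f2) ≤ S₁ + Y-2
  IH-2  = weight-bound m (suc k) (slice f2) (λ c → a≤1 (f2 ∷ c)) σ-out
  free : Y-hi + Y-2 ≤ sumSubsets m (suc k) (λ R → matchWeight (suc m) a (false ∷ R) (embed (σ-out R)))
  free = ≤-trans (≤-reflexive (sym (sumSubsets-+ m (suc k) _ _)))
                 (sumSubsets-mono m (suc k) (λ R _ → free-row R (embed (σ-out R))))
  fixed : Y-lo ≤ sumSubsets m k (λ R → matchWeight (suc m) a (true ∷ R) (embed (σ (true ∷ R))))
  fixed = sumSubsets-mono m k (λ R _ → fixed-row R (σ (true ∷ R)))

⟦_⟧ : Bool → ℕ
⟦ b ⟧ = if b then 1 else 0

count : ∀ {B : Set} → (B → Bool) → List B → ℕ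
count P []       = 0
count P (x ∷ xs) = ⟦ P x ⟧ + count P xs

count-all : ∀ {B : Set} (xs : List B) → count (λ _ → true) xs ≡ length xs
count-all []       = refl
count-all (x ∷ xs) = cong suc (count-all xs)

_≡ᶜ_ : ∀ {m} → Col m → Col m → Bool
x ≡ᶜ c = does (≡-dec _≟_ x c)

multiplicity : ∀ {m} → Matrix m → Col m → ℕ
multiplicity A c = count (_≡ᶜ c) A

multiplicity-absent : ∀ {m} (A : Matrix m) c → All (c ≢_) A → multiplicity A c ≡ 0
multiplicity-absent []      c []          = refl
multiplicity-absent (x ∷ A) c (c≢x ∷ c∉A) with ≡-dec _≟_ x c
... | yes x≡c = ⊥-elim (c≢x (sym x≡c))
... | no  _   = multiplicity-absent A c c∉A

multiplicity-simple : ∀ {m} (A : Matrix m) → Simple A → ∀ c → multiplicity A c ≤ 1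
multiplicity-simple []      _           c = z≤n
multiplicity-simple (x ∷ A) (x∉A ∷ A!) c with ≡-dec _≟_ x c
... | yes refl rewrite multiplicity-absent A x x∉A = s≤s z≤n
... | no  _    = multiplicity-simple A A! c

if-const : ∀ (b : Bool) → (if b then 0 else 0) ≡ 0
if-const true  = refl
if-const false = refl

if-+ : ∀ (b : Bool) x y → (if b then x + y else 0) ≡ (if b then x else 0) + (if b then y else 0)
if-+ true  x y = refl
if-+ false x y = refl

sumCols-point : ∀ m (x : Col m) (P : Col m → Bool) →
                sumCols m (λ c → if P c then ⟦ x ≡ᶜ c ⟧ else 0) ≡ ⟦ P x ⟧
sumCols-point zero [] P = refl
sumCols-point (suc m) (f0 ∷ x) P
  rewrite sumCols-zero m _ (λ c → if-const (P (f1 ∷ c))) | sumCols-zero m _ (λ c → if-const (P (f2 ∷ c)))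
        | sumCols-point m x (P ∘ (f0 ∷_)) = trans (+-identityʳ _) (+-identityʳ _)
sumCols-point (suc m) (f1 ∷ x) P
  rewrite sumCols-zero m _ (λ c → if-const (P (f0 ∷ c))) | sumCols-zero m _ (λ c → if-const (P (f2 ∷ c)))
        | sumCols-point m x (P ∘ (f1 ∷_)) = +-identityʳ _
sumCols-point (suc m) (f2 ∷ x) P
  rewrite sumCols-zero m _ (λ c → if-const (P (f0 ∷ c))) | sumCols-zero m _ (λ c → if-const (P (f1 ∷ c)))
        | sumCols-point m x (P ∘ (f2 ∷_)) = refl

sumCols-multiplicity : ∀ m (A : Matrix m) (P : Col m → Bool) →
                       sumCols m (λ c → if P c then multiplicity A c else 0) ≡ count P A
sumCols-multiplicity m []      P = sumCols-zero m _ (λ c → if-const (P c))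
sumCols-multiplicity m (x ∷ A) P = begin
  sumCols m (λ c → if P c then ⟦ x ≡ᶜ c ⟧ + multiplicity A c else 0)
    ≡⟨ sumCols-cong m (λ c → if-+ (P c) ⟦ x ≡ᶜ c ⟧ (multiplicity A c)) ⟩
  sumCols m (λ c → (if P c then ⟦ x ≡ᶜ c ⟧ else 0) + (if P c then multiplicity A c else 0))
    ≡⟨ sumCols-+ m _ _ ⟩
  sumCols m (λ c → if P c then ⟦ x ≡ᶜ c ⟧ else 0) + sumCols m (λ c → if P c then multiplicity A c else 0)
    ≡⟨ cong₂ _+_ (sumCols-point m x P) (sumCols-multiplicity m A P) ⟩
  ⟦ P x ⟧ + count P A ∎
  where open ≡-Reasoning

simple-bound : ∀ m k (A : Matrix m) → Simple A → (σ : (R : RowSet m) → Vec Bool (size R)) →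
               length A ≤ S m k + sumSubsets m k (λ R → count (matches R (embed (σ R))) A)
simple-bound m k A A! σ =
  subst₂ _≤_ (trans (sumCols-multiplicity m A (λ _ → true)) (count-all A))
             (cong (S m k +_) (sumSubsets-cong (λ R → sumCols-multiplicity m A (matches R (embed (σ R))))))
         (weight-bound m k (multiplicity A) (multiplicity-simple A A!) σ)
  where
  sumSubsets-cong : ∀ {F G : RowSet m → ℕ} → (∀ R → F R ≡ G R) → sumSubsets m k F ≡ sumSubsets m k G
  sumSubsets-cong F≡G = ≤-antisym (sumSubsets-mono m k (λ R _ → ≤-reflexive (F≡G R)))
                                  (sumSubsets-mono m k (λ R _ → ≤-reflexive (sym (F≡G R))))

module _ {B : Set} where

  split : (X Y : List B) → Fin (length (X ++ Y)) → Fin (length X) ⊎ Fin (length Y)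
  split []      Y j       = inj₂ j
  split (x ∷ X) Y zero    = inj₁ zero
  split (x ∷ X) Y (suc j) = Sum.map suc id (split X Y j)

  join : (X Y : List B) → Fin (length X) ⊎ Fin (length Y) → Fin (length (X ++ Y))
  join []      Y (inj₂ i)       = i
  join (x ∷ X) Y (inj₁ zero)    = zero
  join (x ∷ X) Y (inj₁ (suc i)) = suc (join X Y (inj₁ i))
  join (x ∷ X) Y (inj₂ i)       = suc (join X Y (inj₂ i))

  join-split : ∀ X Y j → join X Y (split X Y j) ≡ j
  join-split []      Y j       = refl
  join-split (x ∷ X) Y zero    = refl
  join-split (x ∷ X) Y (suc j) with split X Y j | join-split X Y j
  ... | inj₁ i | e = cong suc e
  ... | inj₂ i | e = cong suc e

  split-join : ∀ X Y u → split X Y (join X Y u) ≡ u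
  split-join []      Y (inj₂ i)       = refl
  split-join (x ∷ X) Y (inj₁ zero)    = refl
  split-join (x ∷ X) Y (inj₁ (suc i)) rewrite split-join X Y (inj₁ i) = refl
  split-join (x ∷ X) Y (inj₂ i)       rewrite split-join X Y (inj₂ i) = refl

  split-injective : ∀ X Y → Injective _≡_ _≡_ (split X Y)
  split-injective X Y {j} {j′} e =
    trans (sym (join-split X Y j)) (trans (cong (join X Y) e) (join-split X Y j′))

  lookup-split : ∀ X Y j → L.lookup (X ++ Y) j ≡ [ L.lookup X , L.lookup Y ]′ (split X Y j)
  lookup-split []      Y j       = refl
  lookup-split (x ∷ X) Y zero    = refl
  lookup-split (x ∷ X) Y (suc j) with split X Y j | lookup-split X Y j
  ... | inj₁ i | e = e
  ... | inj₂ i | e = e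

  lookup-join : ∀ X Y u → L.lookup (X ++ Y) (join X Y u) ≡ [ L.lookup X , L.lookup Y ]′ u
  lookup-join X Y u = trans (lookup-split X Y (join X Y u)) (cong [ L.lookup X , L.lookup Y ]′ (split-join X Y u))

  lookup-unique : ∀ {xs : List B} → Unique xs → ∀ i j → L.lookup xs i ≡ L.lookup xs j → i ≡ j
  lookup-unique {x ∷ xs} _           zero    zero    _ = refl
  lookup-unique {x ∷ xs} (x∉ ∷ _)   zero    (suc j) e = ⊥-elim (all-lookup x∉ (∈-lookup j) e)
  lookup-unique {x ∷ xs} (x∉ ∷ _)   (suc i) zero    e = ⊥-elim (all-lookup x∉ (∈-lookup i) (sym e))
  lookup-unique {x ∷ xs} (_ ∷ xs!)  (suc i) (suc j) e = cong suc (lookup-unique xs! i j e)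

  witness : ∀ (P : B → Bool) xs → 1 ≤ count P xs → Σ (Fin (length xs)) λ i → P (L.lookup xs i) ≡ true
  witness P (x ∷ xs) c≥1 with P x in Px
  ... | true  = zero , Px
  ... | false = Product.map suc id (witness P xs c≥1)

  two-witnesses : ∀ (P : B → Bool) xs → 2 ≤ count P xs →
                  Σ (Fin (length xs)) λ i → Σ (Fin (length xs)) λ j →
                  i ≢ j × P (L.lookup xs i) ≡ true × P (L.lookup xs j) ≡ true
  two-witnesses P (x ∷ xs) c≥2 with P x in Px
  two-witnesses P (x ∷ xs) (s≤s c≥1) | true with witness P xs c≥1
  ... | j , Pj = zero , suc j , (λ ()) , Px , Pj
  two-witnesses P (x ∷ xs) c≥2       | false with two-witnesses P xs c≥2
  ... | i , j , i≢j , Pi , Pj = suc i , suc j , (λ e → i≢j (fin-suc-injective e)) , Pi , Pj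

  witness⇒count : ∀ (P : B → Bool) xs i → P (L.lookup xs i) ≡ true → 1 ≤ count P xs
  witness⇒count P (x ∷ xs) zero    Px rewrite Px = s≤s z≤n
  witness⇒count P (x ∷ xs) (suc i) Pi = ≤-trans (witness⇒count P xs i Pi) (m≤n+m _ ⟦ P x ⟧)

  two-witnesses⇒count : ∀ (P : B → Bool) xs i j → i ≢ j →
                        P (L.lookup xs i) ≡ true → P (L.lookup xs j) ≡ true → 2 ≤ count P xs
  two-witnesses⇒count P (x ∷ xs) zero    zero    i≢j _  _  = ⊥-elim (i≢j refl)
  two-witnesses⇒count P (x ∷ xs) zero    (suc j) _   Px Pj rewrite Px = s≤s (witness⇒count P xs j Pj)
  two-witnesses⇒count P (x ∷ xs) (suc i) zero    i≢j Pi Px = two-witnesses⇒count P (x ∷ xs) zero (suc i) (i≢j ∘ sym) Px Pi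
  two-witnesses⇒count P (x ∷ xs) (suc i) (suc j) i≢j Pi Pj =
    ≤-trans (two-witnesses⇒count P xs i j (i≢j ∘ cong suc) Pi Pj) (m≤n+m _ ⟦ P x ⟧)

restrict : ∀ {m} (R : RowSet m) → Col m → Col (size R)
restrict R c = V.tabulate (lookup c ∘ rowOf R)

matches⇒restrict : ∀ {m} (R : RowSet m) y (c : Col m) → matches R y c ≡ true → y ≡ restrict R c
matches⇒restrict R y c hit =
  trans (sym (tabulate∘lookup y)) (tabulate-cong (λ i → sym (matches-sound R y c hit i)))

-- If each word of a duplicate-free list Ws is read on the rows R by at least two
-- columns of A, then A contains Ws ++ Ws: use the rows R, and send the two copies of
-- each word to two different columns reading it.
doubled-contains : ∀ {m} (A : Matrix m) (R : RowSet m) (Ws : Matrix (size R)) → Unique Ws →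
                   All (λ y → 2 ≤ count (matches R y) A) Ws → Contains A (Ws ++ Ws)
doubled-contains A R Ws Ws! twice =
  rowOf R , rowOf-injective R , column , column-injective , entries
  where
  Copy : Set
  Copy = Fin (length Ws) ⊎ Fin (length Ws)

  word : Copy → Col (size R)
  word = [ L.lookup Ws , L.lookup Ws ]′

  readers : ∀ i → Σ (Fin (length A)) λ a → Σ (Fin (length A)) λ b →
            a ≢ b × matches R (L.lookup Ws i) (L.lookup A a) ≡ true × matches R (L.lookup Ws i) (L.lookup A b) ≡ true
  readers i = two-witnesses (matches R (L.lookup Ws i)) A (all-lookup twice (∈-lookup i))

  reader : Copy → Fin (length A)
  reader (inj₁ i) = proj₁ (readers i)
  reader (inj₂ i) = proj₁ (proj₂ (readers i))

  reads : ∀ u → matches R (word u) (L.lookup A (reader u)) ≡ true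
  reads (inj₁ i) = proj₁ (proj₂ (proj₂ (proj₂ (readers i))))
  reads (inj₂ i) = proj₂ (proj₂ (proj₂ (proj₂ (readers i))))

  -- a column reads a single word on R
  same-word : ∀ u v → reader u ≡ reader v → word u ≡ word v
  same-word u v e = trans (matches⇒restrict R _ _ (reads u))
                          (trans (cong (restrict R ∘ L.lookup A) e) (sym (matches⇒restrict R _ _ (reads v))))

  reader-injective : ∀ u v → reader u ≡ reader v → u ≡ v
  reader-injective (inj₁ i) (inj₁ j) e = cong inj₁ (lookup-unique Ws! i j (same-word (inj₁ i) (inj₁ j) e))
  reader-injective (inj₂ i) (inj₂ j) e = cong inj₂ (lookup-unique Ws! i j (same-word (inj₂ i) (inj₂ j) e))
  reader-injective (inj₁ i) (inj₂ j) e with lookup-unique Ws! i j (same-word (inj₁ i) (inj₂ j) e)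
  ... | refl = ⊥-elim (proj₁ (proj₂ (proj₂ (readers i))) e)
  reader-injective (inj₂ i) (inj₁ j) e with lookup-unique Ws! i j (same-word (inj₂ i) (inj₁ j) e)
  ... | refl = ⊥-elim (proj₁ (proj₂ (proj₂ (readers i))) (sym e))

  column : Fin (length (Ws ++ Ws)) → Fin (length A)
  column = reader ∘ split Ws Ws

  column-injective : Injective _≡_ _≡_ column
  column-injective e = split-injective Ws Ws (reader-injective _ _ e)

  entries : ∀ i j → entry A (rowOf R i) (column j) ≡ entry (Ws ++ Ws) i j
  entries i j = trans (matches-sound R _ _ (reads (split Ws Ws j)) i)
                      (cong (λ y → lookup y i) (sym (lookup-split Ws Ws j)))

prefix-unique : ∀ {n} (v : Fin 3) {X : Matrix n} → Unique X → Unique (map (v ∷_) X)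
prefix-unique v = Unique.map⁺ ∷-injectiveʳ

∈-prefixed : ∀ {n} {v : Fin 3} {X : Matrix n} {c} → c ∈ map (v ∷_) X → V.head c ≡ v
∈-prefixed c∈ with ∈-map⁻ _ c∈
... | _ , _ , refl = refl

prefixed-disjoint : ∀ {n} {v : Fin 3} (X : Matrix n) {Ys : Matrix (suc n)} →
                    (∀ {c} → c ∈ Ys → V.head c ≢ v) → Disjoint (map (v ∷_) X) Ys
prefixed-disjoint X heads (c∈X , c∈Ys) = heads c∈Ys (∈-prefixed {X = X} c∈X)

words : (k s : ℕ) → List (Vec Bool k)
words zero    zero    = [] ∷ []
words zero    (suc s) = []
words (suc k) zero    = map (false ∷_) (words k zero)
words (suc k) (suc s) = map (false ∷_) (words k (suc s)) ++ map (true ∷_) (words k s)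

embed-prefixed : ∀ {k} (b : Bool) (W : List (Vec Bool k)) →
                 map embed (map (b ∷_) W) ≡ map (bit b ∷_) (map embed W)
embed-prefixed b W = trans (sym (map-∘ W)) (map-∘ W)

K-words : ∀ k s → map embed (words k s) ≡ K k s
K-words zero    zero    = refl
K-words zero    (suc s) = refl
K-words (suc k) zero    = trans (embed-prefixed false (words k zero)) (cong (map (f0 ∷_)) (K-words k zero))
K-words (suc k) (suc s) = begin
  map embed (map (false ∷_) (words k (suc s)) ++ map (true ∷_) (words k s))
    ≡⟨ map-++ embed (map (false ∷_) (words k (suc s))) _ ⟩
  map embed (map (false ∷_) (words k (suc s))) ++ map embed (map (true ∷_) (words k s))
    ≡⟨ cong₂ _++_ (embed-prefixed false (words k (suc s))) (embed-prefixed true (words k s)) ⟩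
  map (f0 ∷_) (map embed (words k (suc s))) ++ map (f1 ∷_) (map embed (words k s))
    ≡⟨ cong₂ (λ X Y → map (f0 ∷_) X ++ map (f1 ∷_) Y) (K-words k (suc s)) (K-words k s) ⟩
  K (suc k) (suc s) ∎
  where open ≡-Reasoning

K-unique : ∀ k s → Unique (K k s)
K-unique zero    zero    = [] ∷ []
K-unique zero    (suc s) = []
K-unique (suc k) zero    = prefix-unique f0 (K-unique k zero)
K-unique (suc k) (suc s) =
  Unique.++⁺ (prefix-unique f0 (K-unique k (suc s))) (prefix-unique f1 (K-unique k s))
             (prefixed-disjoint (K k (suc s)) λ c∈ c₀≡f0 → f1≢f0 (trans (sym (∈-prefixed {X = K k s} c∈)) c₀≡f0))
  where
  f1≢f0 : f1 ≢ f0
  f1≢f0 ()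

pick-sparse : ∀ {B : Set} → List B → (B → ℕ) → B → B
pick-sparse []       H d = d
pick-sparse (x ∷ xs) H d = if H x ≤ᵇ 1 then x else pick-sparse xs H d

pick-sparse-spec : ∀ {B : Set} (xs : List B) (H : B → ℕ) d →
                   H (pick-sparse xs H d) ≤ 1 ⊎ All (λ x → 2 ≤ H x) xs
pick-sparse-spec []       H d = inj₂ []
pick-sparse-spec (x ∷ xs) H d with H x ≤ᵇ 1 in le
... | true  = inj₁ (≤ᵇ⇒≤ (H x) 1 (subst T (sym le) tt))
... | false = Sum.map id (≰⇒> (λ Hx≤1 → subst T le (≤⇒≤ᵇ Hx≤1)) ∷_) (pick-sparse-spec xs H d)

upper-bound : ∀ m k s (A : Matrix m) → Simple A → Avoids A (twoK k s) → ncols A ≤ bound m k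
upper-bound m k s A A! avoids = begin
  length A
    ≤⟨ simple-bound m k A A! σ ⟩
  S m k + sumSubsets m k (λ R → readers R (σ R))
    ≤⟨ +-monoʳ-≤ (S m k) (sumSubsets-mono m k sparse) ⟩
  S m k + sumSubsets m k (λ _ → 1)
    ≡⟨ cong (S m k +_) (sumSubsets-count m k) ⟩
  bound m k ∎
  where
  open ≤-Reasoning
  readers : (R : RowSet m) → Vec Bool (size R) → ℕ
  readers R q = count (matches R (embed q)) A
  σ : (R : RowSet m) → Vec Bool (size R)
  σ R = pick-sparse (words (size R) s) (readers R) (V.replicate _ false)
  sparse : ∀ R → size R ≡ k → readers R (σ R) ≤ 1
  sparse R |R|≡k with pick-sparse-spec (words (size R) s) (readers R) (V.replicate _ false)
  ... | inj₁ ≤1    = ≤1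
  ... | inj₂ dense = ⊥-elim (avoids (subst (λ k → Contains A (twoK k s)) |R|≡k
          (doubled-contains A R (K (size R) s) (K-unique (size R) s)
                            (subst (All _) (K-words (size R) s) (All.map⁺ dense)))))

tri : ∀ {m} → Matrix m → Matrix m → Matrix m → Matrix (suc m)
tri X Y Z = map (f2 ∷_) X ++ map (f1 ∷_) Y ++ map (f0 ∷_) Z

-- G m s t: the columns of length m that do not contain the word 1^s 0^t as a
-- subsequence (a leading 1 consumes a 1 of the word while s > 0, a leading 0 consumes
-- a 0 once s = 0).
G : (m s t : ℕ) → Matrix m
G m       zero    zero    = []
G zero    (suc s) t       = [] ∷ []
G zero    zero    (suc t) = [] ∷ []
G (suc m) (suc s) t       = tri (G m (suc s) t) (G m s t) (G m (suc s) t)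
G (suc m) zero    (suc t) = tri (G m zero (suc t)) (G m zero (suc t)) (G m zero t)

-- Opt m s t, the extremal matrix: G m s t together with the C(m,s+t) columns whose
-- entries different from 2 spell exactly the word 1^s 0^t.
Opt : (m s t : ℕ) → Matrix m
Opt m       zero    zero    = V.replicate m f2 ∷ []
Opt zero    (suc s) t       = [] ∷ []
Opt zero    zero    (suc t) = [] ∷ []
Opt (suc m) (suc s) t       = tri (Opt m (suc s) t) (Opt m s t) (G m (suc s) t)
Opt (suc m) zero    (suc t) = tri (Opt m zero (suc t)) (G m zero (suc t)) (Opt m zero t)

tri-unique : ∀ {m} {X Y Z : Matrix m} → Unique X → Unique Y → Unique Z → Unique (tri X Y Z)
tri-unique {X = X} {Y} {Z} X! Y! Z! =
  Unique.++⁺ (prefix-unique f2 X!)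
             (Unique.++⁺ (prefix-unique f1 Y!) (prefix-unique f0 Z!)
                         (prefixed-disjoint Y λ c∈Z c₀≡f1 → f0≢f1 (trans (sym (∈-prefixed {X = Z} c∈Z)) c₀≡f1)))
             (prefixed-disjoint X λ c∈ c₀≡f2 → [ (λ c∈Y → f1≢f2 (trans (sym (∈-prefixed {X = Y} c∈Y)) c₀≡f2))
                                               , (λ c∈Z → f0≢f2 (trans (sym (∈-prefixed {X = Z} c∈Z)) c₀≡f2)) ]′
                                               (∈-++⁻ (map (f1 ∷_) Y) c∈))
  where
  f0≢f1 : f0 ≢ f1
  f0≢f1 ()
  f1≢f2 : f1 ≢ f2
  f1≢f2 ()
  f0≢f2 : f0 ≢ f2
  f0≢f2 ()

G-unique : ∀ m s t → Unique (G m s t)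
G-unique m       zero    zero    = []
G-unique zero    (suc s) t       = [] ∷ []
G-unique zero    zero    (suc t) = [] ∷ []
G-unique (suc m) (suc s) t       = tri-unique (G-unique m (suc s) t) (G-unique m s t) (G-unique m (suc s) t)
G-unique (suc m) zero    (suc t) = tri-unique (G-unique m zero (suc t)) (G-unique m zero (suc t)) (G-unique m zero t)

Opt-unique : ∀ m s t → Unique (Opt m s t)
Opt-unique m       zero    zero    = [] ∷ []
Opt-unique zero    (suc s) t       = [] ∷ []
Opt-unique zero    zero    (suc t) = [] ∷ []
Opt-unique (suc m) (suc s) t       = tri-unique (Opt-unique m (suc s) t) (Opt-unique m s t) (G-unique m (suc s) t)
Opt-unique (suc m) zero    (suc t) = tri-unique (Opt-unique m zero (suc t)) (G-unique m zero (suc t)) (Opt-unique m zero t)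

length-tri : ∀ {m} (X Y Z : Matrix m) → length (tri X Y Z) ≡ length X + length Y + length Z
length-tri X Y Z = begin
  length (map (f2 ∷_) X ++ map (f1 ∷_) Y ++ map (f0 ∷_) Z)
    ≡⟨ length-++ (map (f2 ∷_) X) ⟩
  length (map (f2 ∷_) X) + length (map (f1 ∷_) Y ++ map (f0 ∷_) Z)
    ≡⟨ cong (length (map (f2 ∷_) X) +_) (length-++ (map (f1 ∷_) Y)) ⟩
  length (map (f2 ∷_) X) + (length (map (f1 ∷_) Y) + length (map (f0 ∷_) Z))
    ≡⟨ cong₂ (λ x y → x + (y + length (map (f0 ∷_) Z))) (length-map (f2 ∷_) X) (length-map (f1 ∷_) Y) ⟩
  length X + (length Y + length (map (f0 ∷_) Z))
    ≡⟨ cong (λ z → length X + (length Y + z)) (length-map (f0 ∷_) Z) ⟩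
  length X + (length Y + length Z)
    ≡⟨ +-assoc (length X) (length Y) (length Z) ⟨
  length X + length Y + length Z ∎
  where open ≡-Reasoning

bound-pascal : ∀ m k → bound (suc m) (suc k) ≡ bound m (suc k) + bound m k + S m (suc k)
bound-pascal m k = begin
  S (suc m) (suc k) + (suc m C suc k)
    ≡⟨ cong₂ _+_ (S-pascal m k) (sym (nCk+nC[k+1]≡[n+1]C[k+1] m k)) ⟩
  (S m (suc k) + S m k + S m (suc k)) + ((m C k) + (m C suc k))
    ≡⟨ solve 5 (λ a b c x y → (a :+ b :+ c) :+ (x :+ y) := (a :+ y) :+ (b :+ x) :+ c)
             refl (S m (suc k)) (S m k) (S m (suc k)) (m C k) (m C suc k) ⟩
  bound m (suc k) + bound m k + S m (suc k) ∎
  where open ≡-Reasoning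

G-length : ∀ m s t → length (G m s t) ≡ S m (s + t)
G-length m       zero    zero    = refl
G-length zero    (suc s) t       = sym (S-no-rows (s + t))
G-length zero    zero    (suc t) = sym (S-no-rows t)
G-length (suc m) (suc s) t       = begin
  length (tri (G m (suc s) t) (G m s t) (G m (suc s) t))
    ≡⟨ length-tri (G m (suc s) t) (G m s t) (G m (suc s) t) ⟩
  length (G m (suc s) t) + length (G m s t) + length (G m (suc s) t)
    ≡⟨ cong₂ _+_ (cong₂ _+_ (G-length m (suc s) t) (G-length m s t)) (G-length m (suc s) t) ⟩
  S m (suc (s + t)) + S m (s + t) + S m (suc (s + t))
    ≡⟨ S-pascal m (s + t) ⟨
  S (suc m) (suc (s + t)) ∎
  where open ≡-Reasoning
G-length (suc m) zero    (suc t) = begin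
  length (tri (G m zero (suc t)) (G m zero (suc t)) (G m zero t))
    ≡⟨ length-tri (G m zero (suc t)) (G m zero (suc t)) (G m zero t) ⟩
  length (G m zero (suc t)) + length (G m zero (suc t)) + length (G m zero t)
    ≡⟨ cong₂ _+_ (cong₂ _+_ (G-length m zero (suc t)) (G-length m zero (suc t))) (G-length m zero t) ⟩
  S m (suc t) + S m (suc t) + S m t
    ≡⟨ +-assoc (S m (suc t)) (S m (suc t)) (S m t) ⟩
  S m (suc t) + (S m (suc t) + S m t)
    ≡⟨ cong (S m (suc t) +_) (+-comm (S m (suc t)) (S m t)) ⟩
  S m (suc t) + (S m t + S m (suc t))
    ≡⟨ +-assoc (S m (suc t)) (S m t) (S m (suc t)) ⟨
  S m (suc t) + S m t + S m (suc t)
    ≡⟨ S-pascal m t ⟨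
  S (suc m) (suc t) ∎
  where open ≡-Reasoning

Opt-length : ∀ m s t → length (Opt m s t) ≡ bound m (s + t)
Opt-length m       zero    zero    = refl
Opt-length zero    (suc s) t       = cong (_+ 0) (sym (S-no-rows (s + t)))
Opt-length zero    zero    (suc t) = cong (_+ 0) (sym (S-no-rows t))
Opt-length (suc m) (suc s) t       = begin
  length (tri (Opt m (suc s) t) (Opt m s t) (G m (suc s) t))
    ≡⟨ length-tri (Opt m (suc s) t) (Opt m s t) (G m (suc s) t) ⟩
  length (Opt m (suc s) t) + length (Opt m s t) + length (G m (suc s) t)
    ≡⟨ cong₂ _+_ (cong₂ _+_ (Opt-length m (suc s) t) (Opt-length m s t)) (G-length m (suc s) t) ⟩
  bound m (suc (s + t)) + bound m (s + t) + S m (suc (s + t))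
    ≡⟨ bound-pascal m (s + t) ⟨
  bound (suc m) (suc (s + t)) ∎
  where open ≡-Reasoning
Opt-length (suc m) zero    (suc t) = begin
  length (tri (Opt m zero (suc t)) (G m zero (suc t)) (Opt m zero t))
    ≡⟨ length-tri (Opt m zero (suc t)) (G m zero (suc t)) (Opt m zero t) ⟩
  length (Opt m zero (suc t)) + length (G m zero (suc t)) + length (Opt m zero t)
    ≡⟨ cong₂ _+_ (cong₂ _+_ (Opt-length m zero (suc t)) (G-length m zero (suc t))) (Opt-length m zero t) ⟩
  bound m (suc t) + S m (suc t) + bound m t
    ≡⟨ +-assoc (bound m (suc t)) (S m (suc t)) (bound m t) ⟩
  bound m (suc t) + (S m (suc t) + bound m t)
    ≡⟨ cong (bound m (suc t) +_) (+-comm (S m (suc t)) (bound m t)) ⟩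
  bound m (suc t) + (bound m t + S m (suc t))
    ≡⟨ +-assoc (bound m (suc t)) (bound m t) (S m (suc t)) ⟨
  bound m (suc t) + bound m t + S m (suc t)
    ≡⟨ bound-pascal m t ⟨
  bound (suc m) (suc t) ∎
  where open ≡-Reasoning

prefixOnes : (n s : ℕ) → Vec Bool n
prefixOnes zero    s       = []
prefixOnes (suc n) zero    = false ∷ prefixOnes n zero
prefixOnes (suc n) (suc s) = true ∷ prefixOnes n s

readsPrefix : ∀ {m} → RowSet m → ℕ → Col m → Bool
readsPrefix R s = matches R (embed (prefixOnes (size R) s))

count-++ : ∀ {B : Set} (P : B → Bool) X Y → count P (X ++ Y) ≡ count P X + count P Y
count-++ P []      Y = refl
count-++ P (x ∷ X) Y = trans (cong (⟦ P x ⟧ +_) (count-++ P X Y)) (sym (+-assoc ⟦ P x ⟧ _ _))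

count-map : ∀ {B C : Set} (P : C → Bool) (f : B → C) X → count P (map f X) ≡ count (P ∘ f) X
count-map P f []      = refl
count-map P f (x ∷ X) = cong (⟦ P (f x) ⟧ +_) (count-map P f X)

count-none : ∀ {B : Set} (X : List B) → count (λ _ → false) X ≡ 0
count-none []      = refl
count-none (x ∷ X) = count-none X

count-tri : ∀ {m} (P : Col (suc m) → Bool) (X Y Z : Matrix m) →
            count P (tri X Y Z) ≡ count (P ∘ (f2 ∷_)) X + count (P ∘ (f1 ∷_)) Y + count (P ∘ (f0 ∷_)) Z
count-tri P X Y Z = begin
  count P (map (f2 ∷_) X ++ map (f1 ∷_) Y ++ map (f0 ∷_) Z)
    ≡⟨ count-++ P (map (f2 ∷_) X) _ ⟩
  count P (map (f2 ∷_) X) + count P (map (f1 ∷_) Y ++ map (f0 ∷_) Z)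
    ≡⟨ cong (count P (map (f2 ∷_) X) +_) (count-++ P (map (f1 ∷_) Y) _) ⟩
  count P (map (f2 ∷_) X) + (count P (map (f1 ∷_) Y) + count P (map (f0 ∷_) Z))
    ≡⟨ cong₂ (λ x y → x + (y + count P (map (f0 ∷_) Z))) (count-map P (f2 ∷_) X) (count-map P (f1 ∷_) Y) ⟩
  count (P ∘ (f2 ∷_)) X + (count (P ∘ (f1 ∷_)) Y + count P (map (f0 ∷_) Z))
    ≡⟨ cong (λ z → count (P ∘ (f2 ∷_)) X + (count (P ∘ (f1 ∷_)) Y + z)) (count-map P (f0 ∷_) Z) ⟩
  count (P ∘ (f2 ∷_)) X + (count (P ∘ (f1 ∷_)) Y + count (P ∘ (f0 ∷_)) Z)
    ≡⟨ +-assoc (count (P ∘ (f2 ∷_)) X) _ _ ⟨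
  count (P ∘ (f2 ∷_)) X + count (P ∘ (f1 ∷_)) Y + count (P ∘ (f0 ∷_)) Z ∎
  where open ≡-Reasoning

sum₃≡0 : ∀ {a b c} → a ≡ 0 → b ≡ 0 → c ≡ 0 → a + b + c ≡ 0
sum₃≡0 refl refl refl = refl

no-rows : ∀ s t → 0 ≢ s + suc t
no-rows s t e = 1+n≢0 (trans (sym (+-suc s t)) (sym e))

-- A column of G m s t avoids 1^s 0^t, hence also every longer word 1^s′ 0^t′.
G-unread : ∀ m s t (R : RowSet m) s′ t′ → s ≤ s′ → t ≤ t′ → size R ≡ s′ + t′ →
           count (readsPrefix R s′) (G m s t) ≡ 0
G-unread m       zero    zero    R s′ t′ _ _ _ = refl
G-unread zero    (suc s) t       [] (suc s′) t′ (s≤s _) _ ()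
G-unread zero    zero    (suc t) [] s′ (suc t′) _ (s≤s _) e = ⊥-elim (no-rows s′ t′ e)
G-unread (suc m) (suc s) t (false ∷ R) s′ t′ s≤ t≤ e =
  trans (count-tri (readsPrefix (false ∷ R) s′) (G m (suc s) t) (G m s t) (G m (suc s) t))
        (sum₃≡0 (G-unread m (suc s) t R s′ t′ s≤ t≤ e)
                (G-unread m s t R s′ t′ (≤-trans (n≤1+n s) s≤) t≤ e)
                (G-unread m (suc s) t R s′ t′ s≤ t≤ e))
G-unread (suc m) (suc s) t (true ∷ R) (suc s′) t′ (s≤s s≤) t≤ e =
  trans (count-tri (readsPrefix (true ∷ R) (suc s′)) (G m (suc s) t) (G m s t) (G m (suc s) t))
        (sum₃≡0 (count-none (G m (suc s) t))
                (G-unread m s t R s′ t′ s≤ t≤ (suc-injective e))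
                (count-none (G m (suc s) t)))
G-unread (suc m) zero (suc t) (false ∷ R) s′ t′ s≤ t≤ e =
  trans (count-tri (readsPrefix (false ∷ R) s′) (G m zero (suc t)) (G m zero (suc t)) (G m zero t))
        (sum₃≡0 (G-unread m zero (suc t) R s′ t′ s≤ t≤ e)
                (G-unread m zero (suc t) R s′ t′ s≤ t≤ e)
                (G-unread m zero t R s′ t′ s≤ (≤-trans (n≤1+n t) t≤) e))
G-unread (suc m) zero (suc t) (true ∷ R) zero (suc t′) _ (s≤s t≤) e =
  trans (count-tri (readsPrefix (true ∷ R) zero) (G m zero (suc t)) (G m zero (suc t)) (G m zero t))
        (sum₃≡0 (count-none (G m zero (suc t)))
                (count-none (G m zero (suc t)))
                (G-unread m zero t R zero t′ z≤n t≤ (suc-injective e)))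
G-unread (suc m) zero (suc t) (true ∷ R) (suc s′) t′ _ t≤ e =
  trans (count-tri (readsPrefix (true ∷ R) (suc s′)) (G m zero (suc t)) (G m zero (suc t)) (G m zero t))
        (sum₃≡0 (count-none (G m zero (suc t)))
                (G-unread m zero (suc t) R s′ t′ z≤n t≤ (suc-injective e))
                (count-none (G m zero t)))

twos-unread : ∀ {m} (R : RowSet m) s → 1 ≤ size R → readsPrefix R s (V.replicate m f2) ≡ false
twos-unread (false ∷ R) s       h = twos-unread R s h
twos-unread (true ∷ R)  zero    h = refl
twos-unread (true ∷ R)  (suc s) h = refl

positive-sum : ∀ {s t} → 0 < s ⊎ 0 < t → 1 ≤ s + t
positive-sum {s} {t} (inj₁ 0<s) = ≤-trans 0<s (m≤m+n s t)
positive-sum {s} {t} (inj₂ 0<t) = ≤-trans 0<t (m≤n+m t s)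

-- A column of Opt m s t either avoids 1^s 0^t or has exactly 1^s 0^t as its non-2
-- part, so it reads no strictly longer word 1^s′ 0^t′ on a set of s′+t′ rows.
Opt-unread : ∀ m s t (R : RowSet m) s′ t′ → s ≤ s′ → t ≤ t′ → s < s′ ⊎ t < t′ → size R ≡ s′ + t′ →
             count (readsPrefix R s′) (Opt m s t) ≡ 0
Opt-unread m zero zero R s′ t′ _ _ longer e
  rewrite twos-unread R s′ (subst (1 ≤_) (sym e) (positive-sum longer)) = refl
Opt-unread zero (suc s) t [] (suc s′) t′ (s≤s _) _ _ ()
Opt-unread zero zero (suc t) [] s′ (suc t′) _ (s≤s _) _ e = ⊥-elim (no-rows s′ t′ e)
Opt-unread (suc m) (suc s) t (false ∷ R) s′ t′ s≤ t≤ longer e =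
  trans (count-tri (readsPrefix (false ∷ R) s′) (Opt m (suc s) t) (Opt m s t) (G m (suc s) t))
        (sum₃≡0 (Opt-unread m (suc s) t R s′ t′ s≤ t≤ longer e)
                (Opt-unread m s t R s′ t′ (≤-trans (n≤1+n s) s≤) t≤ (inj₁ s≤) e)
                (G-unread m (suc s) t R s′ t′ s≤ t≤ e))
Opt-unread (suc m) (suc s) t (true ∷ R) (suc s′) t′ (s≤s s≤) t≤ longer e =
  trans (count-tri (readsPrefix (true ∷ R) (suc s′)) (Opt m (suc s) t) (Opt m s t) (G m (suc s) t))
        (sum₃≡0 (count-none (Opt m (suc s) t))
                (Opt-unread m s t R s′ t′ s≤ t≤ (Sum.map₁ s<s⁻¹ longer) (suc-injective e))
                (count-none (G m (suc s) t)))
Opt-unread (suc m) zero (suc t) (false ∷ R) s′ t′ s≤ t≤ longer e =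
  trans (count-tri (readsPrefix (false ∷ R) s′) (Opt m zero (suc t)) (G m zero (suc t)) (Opt m zero t))
        (sum₃≡0 (Opt-unread m zero (suc t) R s′ t′ s≤ t≤ longer e)
                (G-unread m zero (suc t) R s′ t′ s≤ t≤ e)
                (Opt-unread m zero t R s′ t′ s≤ (≤-trans (n≤1+n t) t≤) (inj₂ t≤) e))
Opt-unread (suc m) zero (suc t) (true ∷ R) zero (suc t′) _ (s≤s t≤) longer e =
  trans (count-tri (readsPrefix (true ∷ R) zero) (Opt m zero (suc t)) (G m zero (suc t)) (Opt m zero t))
        (sum₃≡0 (count-none (Opt m zero (suc t)))
                (count-none (G m zero (suc t)))
                (Opt-unread m zero t R zero t′ z≤n t≤ (Sum.map₂ s<s⁻¹ longer) (suc-injective e)))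
Opt-unread (suc m) zero (suc t) (true ∷ R) (suc s′) t′ _ t≤ longer e =
  trans (count-tri (readsPrefix (true ∷ R) (suc s′)) (Opt m zero (suc t)) (G m zero (suc t)) (Opt m zero t))
        (sum₃≡0 (count-none (Opt m zero (suc t)))
                (G-unread m zero (suc t) R s′ t′ z≤n t≤ (suc-injective e))
                (count-none (Opt m zero t)))

Opt-read-once : ∀ m s t (R : RowSet m) → size R ≡ s + t → count (readsPrefix R s) (Opt m s t) ≤ 1
Opt-read-once m zero zero R e with readsPrefix R zero (V.replicate m f2)
... | true  = ≤-refl
... | false = z≤n
Opt-read-once (suc m) (suc s) t (false ∷ R) e =
  subst (_≤ 1) (sym (count-tri (readsPrefix (false ∷ R) (suc s)) (Opt m (suc s) t) (Opt m s t) (G m (suc s) t)))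
    (+-mono-≤ (+-mono-≤ (Opt-read-once m (suc s) t R e)
                        (≤-reflexive (Opt-unread m s t R (suc s) t (n≤1+n s) ≤-refl (inj₁ ≤-refl) e)))
              (≤-reflexive (G-unread m (suc s) t R (suc s) t ≤-refl ≤-refl e)))
Opt-read-once (suc m) (suc s) t (true ∷ R) e =
  subst (_≤ 1) (sym (count-tri (readsPrefix (true ∷ R) (suc s)) (Opt m (suc s) t) (Opt m s t) (G m (suc s) t)))
    (+-mono-≤ (+-mono-≤ (≤-reflexive (count-none (Opt m (suc s) t)))
                        (Opt-read-once m s t R (suc-injective e)))
              (≤-reflexive (count-none (G m (suc s) t))))
Opt-read-once (suc m) zero (suc t) (false ∷ R) e =
  subst (_≤ 1) (sym (count-tri (readsPrefix (false ∷ R) zero) (Opt m zero (suc t)) (G m zero (suc t)) (Opt m zero t)))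
    (+-mono-≤ (+-mono-≤ (Opt-read-once m zero (suc t) R e)
                        (≤-reflexive (G-unread m zero (suc t) R zero (suc t) z≤n ≤-refl e)))
              (≤-reflexive (Opt-unread m zero t R zero (suc t) z≤n (n≤1+n t) (inj₂ ≤-refl) e)))
Opt-read-once (suc m) zero (suc t) (true ∷ R) e =
  subst (_≤ 1) (sym (count-tri (readsPrefix (true ∷ R) zero) (Opt m zero (suc t)) (G m zero (suc t)) (Opt m zero t)))
    (+-mono-≤ (+-mono-≤ (≤-reflexive (count-none (Opt m zero (suc t))))
                        (≤-reflexive (count-none (G m zero (suc t)))))
              (Opt-read-once m zero t R (suc-injective e)))

words-complete : ∀ {k} (b : Vec Bool k) → b ∈ words k (size b)
words-complete []          = here refl
words-complete (true ∷ b)  = ∈-++⁺ʳ (map (false ∷_) (words _ (suc (size b)))) (∈-map⁺ (true ∷_) (words-complete b))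
words-complete (false ∷ b) with size b | words-complete b
... | zero  | b∈ = ∈-map⁺ (false ∷_) b∈
... | suc _ | b∈ = ∈-++⁺ˡ (∈-map⁺ (false ∷_) b∈)

inImage : ∀ {k m} → (Fin k → Fin m) → Fin m → Bool
inImage {zero}  ρ r = false
inImage {suc k} ρ r = does (ρ zero ≟ r) ∨ inImage (ρ ∘ suc) r

inImage-sound : ∀ {k m} (ρ : Fin k → Fin m) r → inImage ρ r ≡ true → Σ (Fin k) λ i → ρ i ≡ r
inImage-sound {suc k} ρ r hit with ρ zero ≟ r
... | yes ρ₀≡r = zero , ρ₀≡r
... | no  _    = Product.map suc id (inImage-sound (ρ ∘ suc) r hit)

∑-ones : ∀ n → ∑ {n} (λ _ → 1) ≡ n
∑-ones zero    = refl
∑-ones (suc n) = cong suc (∑-ones n)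

∑-zero : ∀ m (f : Fin m → ℕ) → (∀ r → f r ≡ 0) → ∑ f ≡ 0
∑-zero m f f≡0 = trans (sum-cong-≗ {m} {f} {λ _ → 0} f≡0) (sum-replicate-zero m)

∑-point : ∀ {m} (p : Fin m) (f : Fin m → ℕ) → ∑ (λ r → if does (p ≟ r) then f r else 0) ≡ f p
∑-point {suc m} zero    f = trans (cong (f zero +_) (∑-zero m _ (λ _ → refl))) (+-identityʳ (f zero))
∑-point {suc m} (suc p) f = ∑-point p (f ∘ suc)

image-sum : ∀ {k m} (ρ : Fin k → Fin m) → Injective _≡_ _≡_ ρ → (f : Fin m → ℕ) →
            ∑ (f ∘ ρ) ≡ ∑ (λ r → if inImage ρ r then f r else 0)
image-sum {zero}  {m} ρ ρ-inj f = sym (∑-zero m _ (λ _ → refl))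
image-sum {suc k} {m} ρ ρ-inj f = begin
  f (ρ zero) + ∑ (f ∘ ρ ∘ suc)
    ≡⟨ cong₂ _+_ (sym (∑-point (ρ zero) f)) (image-sum (ρ ∘ suc) (fin-suc-injective ∘ ρ-inj) f) ⟩
  ∑ (λ r → if does (ρ zero ≟ r) then f r else 0) + ∑ (λ r → if inImage (ρ ∘ suc) r then f r else 0)
    ≡⟨ ∑-distrib-+ (λ r → if does (ρ zero ≟ r) then f r else 0) _ ⟨
  ∑ (λ r → (if does (ρ zero ≟ r) then f r else 0) + (if inImage (ρ ∘ suc) r then f r else 0))
    ≡⟨ sum-cong-≗ split-point ⟩
  ∑ (λ r → if inImage ρ r then f r else 0) ∎
  where
  open ≡-Reasoning
  -- ρ zero is not among ρ (suc i), by injectivity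
  split-point : ∀ r → (if does (ρ zero ≟ r) then f r else 0) + (if inImage (ρ ∘ suc) r then f r else 0)
                      ≡ (if inImage ρ r then f r else 0)
  split-point r with ρ zero ≟ r | inImage (ρ ∘ suc) r in hit
  ... | yes ρ₀≡r | true  = ⊥-elim (fin-0≢1+n (ρ-inj (trans ρ₀≡r (sym (proj₂ (inImage-sound (ρ ∘ suc) r hit))))))
  ... | yes _    | false = +-identityʳ (f r)
  ... | no  _    | true  = refl
  ... | no  _    | false = refl

size-tabulate : ∀ m (g : Fin m → Bool) → size (V.tabulate g) ≡ ∑ (λ r → ⟦ g r ⟧)
size-tabulate zero    g = refl
size-tabulate (suc m) g with g zero
... | true  = cong suc (size-tabulate m (g ∘ suc))
... | false = size-tabulate m (g ∘ suc)

-- prefixOnesAt R s r: r is one of the first s rows of R.  This is the word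
-- prefixOnes (size R) s spread out over the rows R.
prefixOnesAt : ∀ {m} → RowSet m → ℕ → Fin m → Bool
prefixOnesAt (false ∷ R) s       zero    = false
prefixOnesAt (false ∷ R) s       (suc r) = prefixOnesAt R s r
prefixOnesAt (true ∷ R)  zero    zero    = false
prefixOnesAt (true ∷ R)  (suc s) zero    = true
prefixOnesAt (true ∷ R)  zero    (suc r) = prefixOnesAt R zero r
prefixOnesAt (true ∷ R)  (suc s) (suc r) = prefixOnesAt R s r

readsPrefix-from : ∀ {m} (R : RowSet m) s (c : Col m) →
                   (∀ r → lookup R r ≡ true → lookup c r ≡ bit (prefixOnesAt R s r)) → readsPrefix R s c ≡ true
readsPrefix-from []          s       []      h = refl
readsPrefix-from (false ∷ R) s       (v ∷ c) h = readsPrefix-from R s c (h ∘ suc)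
readsPrefix-from (true ∷ R)  zero    (v ∷ c) h rewrite h zero refl = readsPrefix-from R zero c (h ∘ suc)
readsPrefix-from (true ∷ R)  (suc s) (v ∷ c) h rewrite h zero refl = readsPrefix-from R s c (h ∘ suc)

prefixOnesAt-count : ∀ {m} (R : RowSet m) s → s ≤ size R →
                     ∑ (λ r → if lookup R r then ⟦ prefixOnesAt R s r ⟧ else 0) ≡ s
prefixOnesAt-count []          zero    _         = refl
prefixOnesAt-count (false ∷ R) s       s≤        = prefixOnesAt-count R s s≤
prefixOnesAt-count (true ∷ R)  zero    _         = prefixOnesAt-count R zero z≤n
prefixOnesAt-count (true ∷ R)  (suc s) (s≤s s≤)  = cong suc (prefixOnesAt-count R s s≤)

-- A copy of 2·K on the rows ρ would yield, on the row
-- set R = image ρ, two different columns reading 1^s 0^t: the two copies of the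
-- column of K carrying its ones on the first s rows of R.  This contradicts
-- Opt-read-once.
Opt-avoids : ∀ m s t → Avoids (Opt m s t) (twoK (s + t) s)
Opt-avoids m s t (ρ , ρ-inj , τ , τ-inj , entries) = 1+n≰n (≤-trans read-twice (Opt-read-once m s t R |R|))
  where
  open ≡-Reasoning
  k : ℕ
  k = s + t
  A : Matrix m
  A = Opt m s t
  Ks : Matrix k
  Ks = K k s

  R : RowSet m
  R = V.tabulate (inImage ρ)

  |R| : size R ≡ k
  |R| = begin
    size R                             ≡⟨ size-tabulate m (inImage ρ) ⟩
    ∑ (λ r → ⟦ inImage ρ r ⟧)          ≡⟨ image-sum ρ ρ-inj (λ _ → 1) ⟨
    ∑ {k} (λ _ → 1)                    ≡⟨ ∑-ones k ⟩
    k                                  ∎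

  -- the word of K with ones exactly on the first s rows of R
  b : Vec Bool k
  b = V.tabulate (prefixOnesAt R s ∘ ρ)

  |b| : size b ≡ s
  |b| = begin
    size b
      ≡⟨ size-tabulate k (prefixOnesAt R s ∘ ρ) ⟩
    ∑ (λ i → ⟦ prefixOnesAt R s (ρ i) ⟧)
      ≡⟨ image-sum ρ ρ-inj (λ r → ⟦ prefixOnesAt R s r ⟧) ⟩
    ∑ (λ r → if inImage ρ r then ⟦ prefixOnesAt R s r ⟧ else 0)
      ≡⟨ sum-cong-≗ (λ r → cong (λ x → if x then ⟦ prefixOnesAt R s r ⟧ else 0) (sym (lookup∘tabulate (inImage ρ) r))) ⟩
    ∑ (λ r → if lookup R r then ⟦ prefixOnesAt R s r ⟧ else 0)
      ≡⟨ prefixOnesAt-count R s (subst (s ≤_) (sym |R|) (m≤m+n s t)) ⟩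
    s ∎

  b∈K : embed b ∈ Ks
  b∈K = subst (λ n → embed b ∈ K k n) |b|
              (subst (embed b ∈_) (K-words k (size b)) (∈-map⁺ embed (words-complete b)))

  j₁ j₂ : Fin (length (Ks ++ Ks))
  j₁ = join Ks Ks (inj₁ (index b∈K))
  j₂ = join Ks Ks (inj₂ (index b∈K))

  j₁≢j₂ : j₁ ≢ j₂
  j₁≢j₂ e with trans (sym (split-join Ks Ks _)) (trans (cong (split Ks Ks) e) (split-join Ks Ks _))
  ... | ()

  reads-prefix : ∀ j → L.lookup (Ks ++ Ks) j ≡ L.lookup Ks (index b∈K) → readsPrefix R s (L.lookup A (τ j)) ≡ true
  reads-prefix j word≡ = readsPrefix-from R s _ λ r r∈R →
    let (i , ρi≡r) = inImage-sound ρ r (trans (sym (lookup∘tabulate (inImage ρ) r)) r∈R) in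
    subst (λ r → lookup (L.lookup A (τ j)) r ≡ bit (prefixOnesAt R s r)) ρi≡r (begin
      entry A (ρ i) (τ j)                            ≡⟨ entries i j ⟩
      lookup (L.lookup (Ks ++ Ks) j) i               ≡⟨ cong (λ w → lookup w i) (trans word≡ (sym (lookup-index b∈K))) ⟩
      lookup (embed b) i                             ≡⟨ lookup-map i bit b ⟩
      bit (lookup b i)                               ≡⟨ cong bit (lookup∘tabulate (prefixOnesAt R s ∘ ρ) i) ⟩
      bit (prefixOnesAt R s (ρ i))                   ∎)

  read-twice : 2 ≤ count (readsPrefix R s) A
  read-twice = two-witnesses⇒count (readsPrefix R s) A (τ j₁) (τ j₂) (j₁≢j₂ ∘ τ-inj)
                 (reads-prefix j₁ (lookup-join Ks Ks (inj₁ (index b∈K))))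
                 (reads-prefix j₂ (lookup-join Ks Ks (inj₂ (index b∈K))))

lower-bound : ∀ m k s → s ≤ k →
              Σ (Matrix m) λ A → Simple A × Avoids A (twoK k s) × ncols A ≡ bound m k
lower-bound m k s s≤k =
  subst (λ k → Σ (Matrix m) λ A → Simple A × Avoids A (twoK k s) × ncols A ≡ bound m k) (m+[n∸m]≡n s≤k)
        (Opt m s (k ∸ s) , Opt-unique m s (k ∸ s) , Opt-avoids m s (k ∸ s) , Opt-length m s (k ∸ s))

corollary3p6 : (m k s : ℕ) → 1 ≤ m → 1 ≤ k → s ≤ k →
    IsForb m (twoK k s) (bound m k)
corollary3p6 m k s _ _ s≤k = lower-bound m k s s≤k , upper-bound m k s
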